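{- Let $G$ be a deterministic and complete graph. Then $G$ is vertex-transitive if and only if $G$ is edge-transitive.
   Context: A graph is a non-empty set $G\subseteq V\times A\times V$ of labelled edges $s\xrightarrow{a}t$ (for some label set $A$); $V_G$ is the set of vertices occurring in edges and $A_G$ the set of labels occurring. An automorphism is a bijection $h:V_G\to V_G$ with $s\xrightarrow{a}t\iff h(s)\xrightarrow{a}h(t)$. $G$ is vertex-transitive if for all $s,t\in V_G$ some automorphism maps $s$ to $t$; edge-transitive if for all edges $(s,a,t),(s',a,t')\in G$ with the same label there is an automorphism $h$ with $h(s)=s'$ and $h(t)=t'$. $G$ is deterministic if $r\xrightarrow{a}s,\ r\xrightarrow{a}t\Rightarrow s=t$; complete if for every $s\in V_G$ and $a\in A_G$ there is $t$ with $s\xrightarrow{a}t$. -}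

module Defs where

open import Data.Product using (Σ; ∃; ∃-syntax; _×_; _,_)
open import Data.Sum using (_⊎_)
open import Relation.Binary.PropositionalEquality using (_≡_)
open import Function.Bundles using (_⇔_)

-- A graph over vertex type V and label type A: a set of labelled edges,
-- given as a relation  Edge s a t  meaning  s --a--> t.
Graph : Set → Set → Set₁
Graph V A = V → A → V → Set

module _ {V A : Set} (G : Graph V A) where

  NonEmpty : Set
  NonEmpty = ∃[ s ] ∃[ a ] ∃[ t ] G s a t

  InV : V → Set
  InV v = (∃[ a ] ∃[ t ] G v a t) ⊎ (∃[ s ] ∃[ a ] G s a v)

  InA : A → Set
  InA a = ∃[ s ] ∃[ t ] G s a t

  IsAutomorphism : (V → V) → Set
  IsAutomorphism h =
      (∀ v → InV v → InV (h v))
    × (∀ u v → InV u → InV v → h u ≡ h v → u ≡ v)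
    × (∀ w → InV w → ∃[ v ] (InV v × h v ≡ w))
    × (∀ s a t → InV s → InV t → (G s a t ⇔ G (h s) a (h t)))

  VertexTransitive : Set
  VertexTransitive =
    ∀ s t → InV s → InV t → ∃[ h ] (IsAutomorphism h × h s ≡ t)

  EdgeTransitive : Set
  EdgeTransitive =
    ∀ s a t s′ t′ → G s a t → G s′ a t′ →
      ∃[ h ] (IsAutomorphism h × h s ≡ s′ × h t ≡ t′)

  Deterministic : Set
  Deterministic = ∀ r a s t → G r a s → G r a t → s ≡ t

  Complete : Set
  Complete = ∀ s a → InV s → InA a → ∃[ t ] G s a t

-- In a deterministic graph an automorphism is pinned down on an edge by its
-- source: the image of s --a--> t is an a-edge out of h s, and there is only
-- one.  Conversely, in a complete graph every vertex is the source of an edge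
-- with a fixed label, so edge-transitivity moves any vertex to any other.

module Submission where

open import Defs
open import Function.Bundles using (_⇔_; mk⇔; Equivalence)
open import Data.Product using (∃-syntax; _,_)
open import Data.Sum using (inj₁; inj₂)
open import Relation.Binary.PropositionalEquality using (_≡_; subst)

module _ {V A : Set} (G : Graph V A) where

  source-∈V : ∀ {s a t} → G s a t → InV G s
  source-∈V {a = a} {t} e = inj₁ (a , t , e)

  target-∈V : ∀ {s a t} → G s a t → InV G t
  target-∈V {s} {a} e = inj₂ (s , a , e)

  label-∈A : ∀ {s a t} → G s a t → InA G a
  label-∈A {s} {t = t} e = s , t , e

  automorphism-preserves-edge : ∀ {h s a t} → IsAutomorphism G h →
    G s a t → G (h s) a (h t)
  automorphism-preserves-edge {s = s} {a} {t} (_ , _ , _ , preserves) e =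
    Equivalence.to (preserves s a t (source-∈V e) (target-∈V e)) e

  deterministic-vertexTransitive⇒edgeTransitive :
    Deterministic G → VertexTransitive G → EdgeTransitive G
  deterministic-vertexTransitive⇒edgeTransitive det vt s a t s′ t′ e e′
    with vt s s′ (source-∈V e) (source-∈V e′)
  ... | h , aut , hs≡s′ = h , aut , hs≡s′ , det s′ a (h t) t′ e″ e′
    where
    e″ : G s′ a (h t)
    e″ = subst (λ x → G x a (h t)) hs≡s′ (automorphism-preserves-edge aut e)

  complete-edgeTransitive⇒vertexTransitive : ∀ {a} → InA G a →
    Complete G → EdgeTransitive G → VertexTransitive G
  complete-edgeTransitive⇒vertexTransitive {a} a∈A comp et s t s∈V t∈V
    with comp s a s∈V a∈A | comp t a t∈V a∈A
  ... | s₁ , e | t₁ , e′ with et s a s₁ t t₁ e e′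
  ... | h , aut , hs≡t , _ = h , aut , hs≡t

lemma4p9 : {V A : Set} (G : Graph V A) → NonEmpty G → Deterministic G → Complete G →
    VertexTransitive G ⇔ EdgeTransitive G
lemma4p9 G (_ , _ , _ , e) det comp = mk⇔
  (deterministic-vertexTransitive⇒edgeTransitive G det)
  (complete-edgeTransitive⇒vertexTransitive G (label-∈A G e) comp)
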